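{- Let $G$ be a finite simple graph on $n$ vertices and $m$ edges, and let $d_G(v)$ denote the degree of $v$. Then \[ \Bigg(n - \sum_{v\in V(G)} \frac{1}{d_G(v) + 1}\Bigg) \Bigg(n + 1 - \sum_{v\in V(G)} \frac{1}{d_G(v)+1}\Bigg) \geq 2m. \] -}

module Defs where

open import Data.Bool using (Bool; true; false; T)
open import Data.Nat using (ℕ; zero; suc; _<_)
open import Data.Fin using (Fin; toℕ)
open import Data.Fin.Properties using (_<?_)
open import Data.Integer using (+_)
open import Data.Rational as ℚ using (ℚ; _/_)
open import Data.List using (List; []; _∷_; allFin; filter; length; map; foldr; concatMap)
open import Relation.Nullary using (¬_)
open import Relation.Nullary.Decidable using (⌊_⌋)
open import Relation.Binary.PropositionalEquality using (_≡_)

record SimpleGraph (n : ℕ) : Set where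
  field
    Adj   : Fin n → Fin n → Bool
    sym   : ∀ u v → Adj u v ≡ Adj v u
    irrefl : ∀ v → Adj v v ≡ false
open SimpleGraph public

degree : ∀ {n} → SimpleGraph n → Fin n → ℕ
degree G v = length (filter (λ u → Data.Bool._≟_ (Adj G v u) true) (allFin _))
  where import Data.Bool

edgeCount : ∀ {n} → SimpleGraph n → ℕ
edgeCount {n} G =
  length (concatMap (λ u → filter (λ v → Data.Bool._≟_ (Adj G u v Data.Bool.∧ ⌊ u <? v ⌋) true) (allFin n)) (allFin n))
  where import Data.Bool

sumℚ : List ℚ → ℚ
sumℚ = foldr ℚ._+_ ℚ.0ℚ

invDegSum : ∀ {n} → SimpleGraph n → ℚ
invDegSum {n} G = sumℚ (map (λ v → (+ 1) / suc (degree G v)) (allFin n))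

-- Write a_v = 1/(d_v + 1), T = ∑_v d_v/(d_v + 1) = n - ∑_v a_v, and let P be the number of
-- non-isolated vertices. The closed neighbourhood of a non-isolated vertex v consists of
-- non-isolated vertices, so d_v + 1 ≤ P, and therefore
--   d_v + (P - 1) ≤ 2P d_v/(d_v + 1)   (the gap is a_v (d_v - 1)(P - d_v - 1))   and   1 ≤ P a_v.
-- Summing over the non-isolated vertices and using ∑_v d_v = 2m gives 2m + P(P - 1) ≤ 2PT and
-- P ≤ P(P - T). Hence Y = P - T is at least 1 when P > 0, and Y = -T ≤ 0 when P = 0; either way
-- Y(Y - 1) ≥ 0, and T(T + 1) = 2PT - P(P - 1) + Y(Y - 1) ≥ 2m.
module Submission where

open import Algebra.Bundles using (Monoid; CommutativeRing)
import Algebra.Properties.Monoid.Sum as MonoidSum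
import Algebra.Properties.Semiring.Sum as SemiringSum
open import Data.Bool.Base using (Bool; true; false; _∧_)
import Data.Bool.Properties as Bool
open import Data.Fin.Base using (Fin; zero; suc; punchIn)
open import Data.Fin.Properties using (_<?_; <-asym; ≤-antisym)
open import Data.Integer.Base using (+_)
import Data.Integer.Properties as ℤ
open import Data.List.Base using (List; tabulate; filter; length; concatMap; foldr; allFin)
open import Data.List.Properties using (length-++; map-tabulate; filter-some)
open import Data.List.Membership.Propositional.Properties using (∈-allFin)
import Data.List.Relation.Unary.Any as Any
open import Data.Nat.Base as ℕ using (ℕ; zero; suc; z≤n; s≤s; z<s)
import Data.Nat.Properties as ℕ
import Data.Nat.Coprimality as Coprime
open import Data.Product.Base using (_,_)
open import Data.Rational.Base as ℚ using (ℚ; 0ℚ; 1ℚ; mkℚ; _/_; _+_; _*_; _-_; _≤_)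
import Data.Rational.Properties as ℚ
open import Data.Vec.Functional as Vector using (Vector; removeAt)
open import Function.Base using (_∘_; id)
open import Relation.Binary.Core using (Rel; _Preserves₂_⟶_⟶_)
open import Relation.Binary.Definitions using (Reflexive)
open import Relation.Binary.PropositionalEquality as ≡ using (_≡_; refl; cong; cong₂; subst; subst₂)
open import Relation.Nullary.Decidable using (yes; no; ⌊_⌋; dec⇒maybe)
open import Relation.Nullary.Negation using (contradiction)
open import Tactic.RingSolver using (solve-∀)
import Tactic.RingSolver.Core.AlmostCommutativeRing as ACR

open import Defs

ℚ-ring : ACR.AlmostCommutativeRing _ _
ℚ-ring = ACR.fromCommutativeRing ℚ.+-*-commutativeRing (λ x → dec⇒maybe (0ℚ ℚ.≟ x))

module ℕΣ = SemiringSum ℕ.+-*-semiring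
module ℚΣ = SemiringSum (CommutativeRing.semiring ℚ.+-*-commutativeRing)
open ℚΣ using (sum-syntax)

module _ {a ℓ} (M : Monoid a ℓ) where
  open Monoid M
  open MonoidSum M using (sum)

  sum-mono : ∀ {r} (_≲_ : Rel Carrier r) → Reflexive _≲_ → _∙_ Preserves₂ _≲_ ⟶ _≲_ ⟶ _≲_ →
             ∀ {n} {f g : Vector Carrier n} → (∀ i → f i ≲ g i) → sum f ≲ sum g
  sum-mono _≲_ ≲-refl ∙-mono {zero}  f≲g = ≲-refl
  sum-mono _≲_ ≲-refl ∙-mono {suc n} {f} {g} f≲g =
    ∙-mono {f zero} {g zero} {sum (f ∘ suc)} {sum (g ∘ suc)}
           (f≲g zero) (sum-mono _≲_ ≲-refl ∙-mono (f≲g ∘ suc))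

ℕ-sum-mono-≤ : ∀ {n} {f g : Vector ℕ n} → (∀ i → f i ℕ.≤ g i) → ℕΣ.sum f ℕ.≤ ℕΣ.sum g
ℕ-sum-mono-≤ {n} {f} {g} = sum-mono ℕ.+-0-monoid ℕ._≤_ ℕ.≤-refl ℕ.+-mono-≤ {n} {f} {g}

ℕ-sum-mono-< : ∀ {n} {f g : Vector ℕ n} i → (∀ j → f j ℕ.≤ g j) → f i ℕ.< g i →
               ℕΣ.sum f ℕ.< ℕΣ.sum g
ℕ-sum-mono-< {suc n} {f} {g} i f≤g fi<gi = begin-strict
  ℕΣ.sum f                           ≡⟨ ℕΣ.sum-remove {i = i} f ⟩
  f i ℕ.+ ℕΣ.sum (removeAt f i)      <⟨ ℕ.+-mono-<-≤ fi<gi (ℕ-sum-mono-≤ (f≤g ∘ punchIn i)) ⟩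
  g i ℕ.+ ℕΣ.sum (removeAt g i)      ≡⟨ ℕΣ.sum-remove {i = i} g ⟨
  ℕΣ.sum g                           ∎
  where open ℕ.≤-Reasoning

ℚ-sum-mono-≤ : ∀ {n} {f g : Vector ℚ n} → (∀ i → f i ≤ g i) → ∑[ i < n ] f i ≤ ∑[ i < n ] g i
ℚ-sum-mono-≤ {n} {f} {g} = sum-mono ℚ.+-0-monoid _≤_ ℚ.≤-refl ℚ.+-mono-≤ {n} {f} {g}

∑-distrib-- : ∀ {n} (f g : Vector ℚ n) → ∑[ i < n ] (f i - g i) ≡ ∑[ i < n ] f i - ∑[ i < n ] g i
∑-distrib-- {zero}  f g = refl
∑-distrib-- {suc n} f g =
  ≡.trans (cong (_+_ (f zero - g zero)) (∑-distrib-- (f ∘ suc) (g ∘ suc))) (interchange (f zero) (g zero) _ _)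
  where
  interchange : ∀ a b c d → (a - b) + (c - d) ≡ (a + c) - (b + d)
  interchange = solve-∀ ℚ-ring

foldr-tabulate : ∀ {a b} {A : Set a} {B : Set b} (_⊕_ : A → B → B) e {n} (f : Fin n → A) →
                 foldr _⊕_ e (tabulate f) ≡ Vector.foldr _⊕_ e f
foldr-tabulate _⊕_ e {zero}  f = refl
foldr-tabulate _⊕_ e {suc n} f = cong (f zero ⊕_) (foldr-tabulate _⊕_ e (f ∘ suc))

𝟙 : Bool → ℕ
𝟙 true  = 1
𝟙 false = 0

length-filter-tabulate : ∀ {a} {A : Set a} {n} (p : A → Bool) (f : Fin n → A) →
                         length (filter (λ x → p x Bool.≟ true) (tabulate f)) ≡ ℕΣ.sum (𝟙 ∘ p ∘ f)
length-filter-tabulate {n = zero}  p f = refl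
length-filter-tabulate {n = suc n} p f with p (f zero)
... | true  = cong suc (length-filter-tabulate p (f ∘ suc))
... | false = length-filter-tabulate p (f ∘ suc)

length-concatMap-tabulate : ∀ {a b} {A : Set a} {B : Set b} {n} (h : A → List B) (f : Fin n → A) →
                            length (concatMap h (tabulate f)) ≡ ℕΣ.sum (length ∘ h ∘ f)
length-concatMap-tabulate {n = zero}  h f = refl
length-concatMap-tabulate {n = suc n} h f =
  ≡.trans (length-++ (h (f zero))) (cong (length (h (f zero)) ℕ.+_) (length-concatMap-tabulate h (f ∘ suc)))

p≤p+q : ∀ {p q} → 0ℚ ≤ q → p ≤ p + q
p≤p+q {p} {q} 0≤q = subst (_≤ p + q) (ℚ.+-identityʳ p) (ℚ.+-monoʳ-≤ p 0≤q)

p≤q⇒0≤q-p : ∀ {p q} → p ≤ q → 0ℚ ≤ q - p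
p≤q⇒0≤q-p {p} {q} p≤q = subst (_≤ q - p) (ℚ.+-inverseʳ p) (ℚ.+-monoˡ-≤ (ℚ.- p) p≤q)

+-cancelʳ-≤ : ∀ r {p q} → p + r ≤ q + r → p ≤ q
+-cancelʳ-≤ r {p} {q} p+r≤q+r = subst₂ _≤_ (cancel p r) (cancel q r) (ℚ.+-monoˡ-≤ (ℚ.- r) p+r≤q+r)
  where
  cancel : ∀ x y → x + y - y ≡ x
  cancel = solve-∀ ℚ-ring

*-nonNeg : ∀ {p q} → 0ℚ ≤ p → 0ℚ ≤ q → 0ℚ ≤ p * q
*-nonNeg {p} {q} 0≤p 0≤q =
  ℚ.nonNegative⁻¹ _ {{ℚ.nonNeg*nonNeg⇒nonNeg p {{ℚ.nonNegative 0≤p}} q {{ℚ.nonNegative 0≤q}}}}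

ι : ℕ → ℚ
ι n = + n / 1

ι≡mkℚ : ∀ n → ι n ≡ mkℚ (+ n) 0 (Coprime.sym (Coprime.1-coprimeTo n))
ι≡mkℚ n = ℚ.normalize-coprime (Coprime.sym (Coprime.1-coprimeTo n))

ι-+ : ∀ m n → ι (m ℕ.+ n) ≡ ι m + ι n
ι-+ m n rewrite ι≡mkℚ m | ι≡mkℚ n | ℤ.*-identityʳ (+ m) | ℤ.*-identityʳ (+ n) = refl

ι-suc : ∀ n → ι (suc n) ≡ 1ℚ + ι n
ι-suc = ι-+ 1

ι-nonNeg : ∀ n → 0ℚ ≤ ι n
ι-nonNeg n = ℚ.nonNegative⁻¹ (ι n) {{ℚ.normalize-nonNeg n 1}}

ι-mono-≤ : ∀ {m n} → m ℕ.≤ n → ι m ≤ ι n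
ι-mono-≤ {m} m≤n with k , refl ← ℕ.m≤n⇒∃[o]m+o≡n m≤n =
  subst (ι m ≤_) (≡.sym (ι-+ m k)) (p≤p+q (ι-nonNeg k))

ι-sum : ∀ {n} (f : Vector ℕ n) → ι (ℕΣ.sum f) ≡ ∑[ i < n ] ι (f i)
ι-sum {zero}  f = refl
ι-sum {suc n} f = ≡.trans (ι-+ (f zero) _) (cong (_+_ (ι (f zero))) (ι-sum (f ∘ suc)))

∑-one : ∀ n → ∑[ i < n ] 1ℚ ≡ ι n
∑-one zero    = refl
∑-one (suc n) = ≡.trans (cong (_+_ 1ℚ) (∑-one n)) (≡.sym (ι-suc n))

1/suc : ℕ → ℚ
1/suc d = + 1 / suc d

degRatio : ℕ → ℚ
degRatio d = 1ℚ - 1/suc d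

1/suc-nonNeg : ∀ d → 0ℚ ≤ 1/suc d
1/suc-nonNeg d = ℚ.nonNegative⁻¹ (1/suc d) {{ℚ.normalize-nonNeg 1 (suc d)}}

[1+ι]*1/suc≡1 : ∀ d → (1ℚ + ι d) * 1/suc d ≡ 1ℚ
[1+ι]*1/suc≡1 d rewrite ≡.sym (ι-suc d) | ι≡mkℚ (suc d)
                      | ℚ.normalize-coprime {1} {d} (Coprime.1-coprimeTo (suc d)) =
  ℚ.*-inverseʳ (mkℚ (+ suc d) 0 (Coprime.sym (Coprime.1-coprimeTo (suc d))))

degRatio≡ι*1/suc : ∀ d → degRatio d ≡ ι d * 1/suc d
degRatio≡ι*1/suc d = begin
  1ℚ - 1/suc d                        ≡⟨ cong (_- 1/suc d) ([1+ι]*1/suc≡1 d) ⟨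
  (1ℚ + ι d) * 1/suc d - 1/suc d      ≡⟨ distrib (ι d) (1/suc d) ⟩
  ι d * 1/suc d                       ∎
  where
  open ≡.≡-Reasoning
  distrib : ∀ x a → (1ℚ + x) * a - a ≡ x * a
  distrib = solve-∀ ℚ-ring

degRatio-nonNeg : ∀ d → 0ℚ ≤ degRatio d
degRatio-nonNeg d = subst (0ℚ ≤_) (≡.sym (degRatio≡ι*1/suc d)) (*-nonNeg (ι-nonNeg d) (1/suc-nonNeg d))

d+[N-1]≤[N+N]*[d*a] : ∀ {a d N} → 0ℚ ≤ a → (1ℚ + d) * a ≡ 1ℚ → 1ℚ ≤ d → 1ℚ + d ≤ N →
                      d + (N - 1ℚ) ≤ (N + N) * (d * a)
d+[N-1]≤[N+N]*[d*a] {a} {d} {N} 0≤a inverse 1≤d 1+d≤N = begin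
  d + (N - 1ℚ)                                                        ≡⟨ ℚ.*-identityʳ _ ⟨
  (d + (N - 1ℚ)) * 1ℚ                                                 ≡⟨ cong (_*_ (d + (N - 1ℚ))) inverse ⟨
  (d + (N - 1ℚ)) * ((1ℚ + d) * a)                                     ≤⟨ p≤p+q slack-nonNeg ⟩
  (d + (N - 1ℚ)) * ((1ℚ + d) * a) + a * ((d - 1ℚ) * (N - (1ℚ + d)))  ≡⟨ identity a d N ⟩
  (N + N) * (d * a)                                                   ∎
  where
  open ℚ.≤-Reasoning
  slack-nonNeg : 0ℚ ≤ a * ((d - 1ℚ) * (N - (1ℚ + d)))
  slack-nonNeg = *-nonNeg 0≤a (*-nonNeg (p≤q⇒0≤q-p 1≤d) (p≤q⇒0≤q-p 1+d≤N))
  identity : ∀ a d N →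
             (d + (N - 1ℚ)) * ((1ℚ + d) * a) + a * ((d - 1ℚ) * (N - (1ℚ + d))) ≡ (N + N) * (d * a)
  identity = solve-∀ ℚ-ring

sgn : ℕ → ℕ
sgn zero    = 0
sgn (suc _) = 1

0<sgn : ∀ {d} → 0 ℕ.< d → 0 ℕ.< sgn d
0<sgn {suc _} _ = z<s

1+ι≤ι : ∀ {d N} → d ℕ.< N → 1ℚ + ι d ≤ ι N
1+ι≤ι {d} {N} d<N = subst (_≤ ι N) (ι-suc d) (ι-mono-≤ d<N)

-- The factor sgn d switches both bounds off at isolated vertices, so they can be summed over all
-- vertices with N the number of non-isolated ones.
vertex-degree-bound : ∀ d N → (0 ℕ.< d → d ℕ.< N) →
                      ι d + ι (sgn d) * (ι N - 1ℚ) ≤ (ι N + ι N) * degRatio d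
vertex-degree-bound zero N _ = ℚ.≤-reflexive (isolated (ι N))
  where
  isolated : ∀ N → 0ℚ + 0ℚ * (N - 1ℚ) ≡ (N + N) * (1ℚ - 1ℚ)
  isolated = solve-∀ ℚ-ring
vertex-degree-bound d@(suc _) N d<N = begin
  ι d + 1ℚ * (ι N - 1ℚ)           ≡⟨ cong (_+_ (ι d)) (ℚ.*-identityˡ _) ⟩
  ι d + (ι N - 1ℚ)                ≤⟨ d+[N-1]≤[N+N]*[d*a] {1/suc d} {ι d} {ι N} (1/suc-nonNeg d) ([1+ι]*1/suc≡1 d)
                                                          (ι-mono-≤ {1} {d} (s≤s z≤n)) (1+ι≤ι (d<N z<s)) ⟩
  (ι N + ι N) * (ι d * 1/suc d)   ≡⟨ cong (_*_ (ι N + ι N)) (degRatio≡ι*1/suc d) ⟨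
  (ι N + ι N) * degRatio d        ∎
  where open ℚ.≤-Reasoning

vertex-weight-bound : ∀ d N → (0 ℕ.< d → d ℕ.< N) → ι (sgn d) ≤ ι N * (ι (sgn d) - degRatio d)
vertex-weight-bound zero N _ = ℚ.≤-reflexive (isolated (ι N))
  where
  isolated : ∀ N → 0ℚ ≡ N * (0ℚ - (1ℚ - 1ℚ))
  isolated = solve-∀ ℚ-ring
vertex-weight-bound d@(suc _) N d<N = begin
  1ℚ                              ≡⟨ [1+ι]*1/suc≡1 d ⟨
  (1ℚ + ι d) * 1/suc d            ≤⟨ ℚ.*-monoʳ-≤-nonNeg (1/suc d) {{ℚ.nonNegative (1/suc-nonNeg d)}}
                                                        (1+ι≤ι (d<N z<s)) ⟩
  ι N * 1/suc d                   ≡⟨ cong (_*_ (ι N)) (1-[1-p]≡p (1/suc d)) ⟨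
  ι N * (1ℚ - degRatio d)         ∎
  where
  open ℚ.≤-Reasoning
  1-[1-p]≡p : ∀ p → 1ℚ - (1ℚ - p) ≡ p
  1-[1-p]≡p = solve-∀ ℚ-ring

[P-T]*[P-T-1]-nonNeg : ∀ p {T} → ι p ≤ ι p * (ι p - T) → 0ℚ ≤ T →
                       0ℚ ≤ (ι p - T) * (ι p - T - 1ℚ)
[P-T]*[P-T-1]-nonNeg zero {T} _ 0≤T =
  subst (0ℚ ≤_) (negate T) (*-nonNeg 0≤T (ℚ.≤-trans 0≤T (p≤p+q (ℚ.nonNegative⁻¹ 1ℚ))))
  where
  negate : ∀ T → T * (T + 1ℚ) ≡ (0ℚ - T) * (0ℚ - T - 1ℚ)
  negate = solve-∀ ℚ-ring
[P-T]*[P-T-1]-nonNeg p@(suc _) {T} P≤P[P-T] _ =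
  *-nonNeg (ℚ.≤-trans (ℚ.nonNegative⁻¹ 1ℚ) 1≤P-T) (p≤q⇒0≤q-p 1≤P-T)
  where
  1≤P-T : 1ℚ ≤ ι p - T
  1≤P-T = ℚ.*-cancelˡ-≤-pos (ι p) {{ℚ.normalize-pos p 1}}
            (subst (_≤ ι p * (ι p - T)) (≡.sym (ℚ.*-identityʳ (ι p))) P≤P[P-T])

quadratic-bound : ∀ p {M T} → M + ι p * (ι p - 1ℚ) ≤ (ι p + ι p) * T → ι p ≤ ι p * (ι p - T) →
                  0ℚ ≤ T → M ≤ T * (T + 1ℚ)
quadratic-bound p {M} {T} M-bound P-bound 0≤T = +-cancelʳ-≤ (P * (P - 1ℚ)) (begin
  M + P * (P - 1ℚ)                         ≤⟨ M-bound ⟩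
  (P + P) * T                              ≤⟨ p≤p+q ([P-T]*[P-T-1]-nonNeg p P-bound 0≤T) ⟩
  (P + P) * T + (P - T) * (P - T - 1ℚ)     ≡⟨ complete-square P T ⟩
  T * (T + 1ℚ) + P * (P - 1ℚ)              ∎)
  where
  open ℚ.≤-Reasoning
  P = ι p
  complete-square : ∀ P T → (P + P) * T + (P - T) * (P - T - 1ℚ) ≡ T * (T + 1ℚ) + P * (P - 1ℚ)
  complete-square = solve-∀ ℚ-ring

module _ {n} (G : SimpleGraph n) where

  upEdge : Fin n → Fin n → ℕ
  upEdge u v = 𝟙 (Adj G u v ∧ ⌊ u <? v ⌋)

  degree≡∑ : ∀ v → degree G v ≡ ℕΣ.sum (𝟙 ∘ Adj G v)
  degree≡∑ v = length-filter-tabulate (Adj G v) id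

  edgeCount≡∑ : edgeCount G ≡ ℕΣ.sum (λ u → ℕΣ.sum (upEdge u))
  edgeCount≡∑ = ≡.trans
    (length-concatMap-tabulate (λ u → filter (λ v → (Adj G u v ∧ ⌊ u <? v ⌋) Bool.≟ true) (allFin n)) id)
    (ℕΣ.sum-cong-≗ (λ u → length-filter-tabulate (λ v → Adj G u v ∧ ⌊ u <? v ⌋) id))

  𝟙-Adj≡upEdge+upEdge : ∀ u v → 𝟙 (Adj G u v) ≡ upEdge u v ℕ.+ upEdge v u
  𝟙-Adj≡upEdge+upEdge u v with u <? v | v <? u
  ... | yes u<v | yes v<u = contradiction v<u (<-asym u<v)
  ... | yes _   | no _
    rewrite Bool.∧-identityʳ (Adj G u v) | Bool.∧-zeroʳ (Adj G v u) = ≡.sym (ℕ.+-identityʳ _)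
  ... | no _    | yes _
    rewrite Bool.∧-zeroʳ (Adj G u v) | Bool.∧-identityʳ (Adj G v u) | sym G u v = refl
  ... | no u≮v  | no v≮u
    with refl ← ≤-antisym (ℕ.≮⇒≥ v≮u) (ℕ.≮⇒≥ u≮v) rewrite irrefl G u = refl

  handshake : ℕΣ.sum (degree G) ≡ 2 ℕ.* edgeCount G
  handshake = begin
    ℕΣ.sum (degree G)
      ≡⟨ ℕΣ.sum-cong-≗ (λ u → ≡.trans (degree≡∑ u) (ℕΣ.sum-cong-≗ (𝟙-Adj≡upEdge+upEdge u))) ⟩
    ℕΣ.sum (λ u → ℕΣ.sum (λ v → upEdge u v ℕ.+ upEdge v u))
      ≡⟨ ℕΣ.sum-cong-≗ (λ u → ℕΣ.∑-distrib-+ (upEdge u) (λ v → upEdge v u)) ⟩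
    ℕΣ.sum (λ u → ℕΣ.sum (upEdge u) ℕ.+ ℕΣ.sum (λ v → upEdge v u))
      ≡⟨ ℕΣ.∑-distrib-+ (λ u → ℕΣ.sum (upEdge u)) (λ u → ℕΣ.sum (λ v → upEdge v u)) ⟩
    ℕΣ.sum (λ u → ℕΣ.sum (upEdge u)) ℕ.+ ℕΣ.sum (λ u → ℕΣ.sum (λ v → upEdge v u))
      ≡⟨ cong (ℕ._+_ _) (ℕΣ.∑-comm (λ u v → upEdge v u)) ⟩
    ℕΣ.sum (λ u → ℕΣ.sum (upEdge u)) ℕ.+ ℕΣ.sum (λ v → ℕΣ.sum (upEdge v))
      ≡⟨ cong₂ ℕ._+_ edgeCount≡∑ edgeCount≡∑ ⟨
    edgeCount G ℕ.+ edgeCount G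
      ≡⟨ cong (ℕ._+_ (edgeCount G)) (ℕ.+-identityʳ (edgeCount G)) ⟨
    2 ℕ.* edgeCount G
      ∎
    where open ≡.≡-Reasoning

  nonIsolated : ℕ
  nonIsolated = ℕΣ.sum (sgn ∘ degree G)

  adjacent⇒degree>0 : ∀ {u v} → Adj G u v ≡ true → 0 ℕ.< degree G u
  adjacent⇒degree>0 {u} {v} uv =
    filter-some (λ w → Adj G u w Bool.≟ true) (Any.map (λ { refl → uv }) (∈-allFin v))

  𝟙-Adj≤sgn-degree : ∀ v u → 𝟙 (Adj G v u) ℕ.≤ sgn (degree G u)
  𝟙-Adj≤sgn-degree v u with Adj G v u in vu
  ... | false = z≤n
  ... | true  = 0<sgn (adjacent⇒degree>0 (≡.trans (sym G u v) vu))

  degree<nonIsolated : ∀ v → 0 ℕ.< degree G v → degree G v ℕ.< nonIsolated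
  degree<nonIsolated v 0<d = subst (ℕ._< nonIsolated) (≡.sym (degree≡∑ v))
    (ℕ-sum-mono-< v (𝟙-Adj≤sgn-degree v)
      (subst (λ b → 𝟙 b ℕ.< sgn (degree G v)) (≡.sym (irrefl G v)) (0<sgn 0<d)))

  private
    d : Fin n → ℕ
    d = degree G

    P : ℚ
    P = ι nonIsolated

  degRatioSum : ℚ
  degRatioSum = ∑[ v < n ] degRatio (d v)

  degRatioSum≡n-invDegSum : degRatioSum ≡ ι n - invDegSum G
  degRatioSum≡n-invDegSum = begin
    ∑[ v < n ] (1ℚ - 1/suc (d v))
      ≡⟨ ∑-distrib-- (λ _ → 1ℚ) (1/suc ∘ d) ⟩
    ∑[ v < n ] 1ℚ - ∑[ v < n ] 1/suc (d v)
      ≡⟨ cong₂ _-_ (∑-one n) (≡.sym (foldr-tabulate _+_ 0ℚ (1/suc ∘ d))) ⟩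
    ι n - foldr _+_ 0ℚ (tabulate (1/suc ∘ d))
      ≡⟨ cong (λ xs → ι n - foldr _+_ 0ℚ xs) (map-tabulate id (1/suc ∘ d)) ⟨
    ι n - invDegSum G
      ∎
    where open ≡.≡-Reasoning

  degree-sum-bound : ι (2 ℕ.* edgeCount G) + P * (P - 1ℚ) ≤ (P + P) * degRatioSum
  degree-sum-bound = begin
    ι (2 ℕ.* edgeCount G) + P * (P - 1ℚ)
      ≡⟨ cong (λ x → ι x + P * (P - 1ℚ)) handshake ⟨
    ι (ℕΣ.sum d) + ι (ℕΣ.sum (sgn ∘ d)) * (P - 1ℚ)
      ≡⟨ cong₂ (λ x y → x + y * (P - 1ℚ)) (ι-sum d) (ι-sum (sgn ∘ d)) ⟩
    ∑[ v < n ] ι (d v) + (∑[ v < n ] ι (sgn (d v))) * (P - 1ℚ)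
      ≡⟨ cong (_+_ (∑[ v < n ] ι (d v))) (ℚΣ.*-distribʳ-sum (P - 1ℚ) (ι ∘ sgn ∘ d)) ⟩
    ∑[ v < n ] ι (d v) + ∑[ v < n ] (ι (sgn (d v)) * (P - 1ℚ))
      ≡⟨ ℚΣ.∑-distrib-+ (ι ∘ d) (λ v → ι (sgn (d v)) * (P - 1ℚ)) ⟨
    ∑[ v < n ] (ι (d v) + ι (sgn (d v)) * (P - 1ℚ))
      ≤⟨ ℚ-sum-mono-≤ (λ v → vertex-degree-bound (d v) nonIsolated (degree<nonIsolated v)) ⟩
    ∑[ v < n ] ((P + P) * degRatio (d v))
      ≡⟨ ℚΣ.*-distribˡ-sum (P + P) (degRatio ∘ d) ⟨
    (P + P) * degRatioSum
      ∎
    where open ℚ.≤-Reasoning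

  nonIsolated-bound : P ≤ P * (P - degRatioSum)
  nonIsolated-bound = begin
    P
      ≡⟨ ι-sum (sgn ∘ d) ⟩
    ∑[ v < n ] ι (sgn (d v))
      ≤⟨ ℚ-sum-mono-≤ (λ v → vertex-weight-bound (d v) nonIsolated (degree<nonIsolated v)) ⟩
    ∑[ v < n ] (P * (ι (sgn (d v)) - degRatio (d v)))
      ≡⟨ ℚΣ.*-distribˡ-sum P (λ v → ι (sgn (d v)) - degRatio (d v)) ⟨
    P * ∑[ v < n ] (ι (sgn (d v)) - degRatio (d v))
      ≡⟨ cong (_*_ P) (∑-distrib-- (ι ∘ sgn ∘ d) (degRatio ∘ d)) ⟩
    P * (∑[ v < n ] ι (sgn (d v)) - degRatioSum)
      ≡⟨ cong (λ x → P * (x - degRatioSum)) (ι-sum (sgn ∘ d)) ⟨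
    P * (P - degRatioSum)
      ∎
    where open ℚ.≤-Reasoning

  degRatioSum-nonNeg : 0ℚ ≤ degRatioSum
  degRatioSum-nonNeg = subst (_≤ degRatioSum) (ℚΣ.sum-replicate-zero n) (ℚ-sum-mono-≤ (degRatio-nonNeg ∘ d))

lemma5p2 : (n : ℕ) (G : SimpleGraph n) →
    ((+ (2 ℕ.* edgeCount G)) / 1) ≤
      ((+ n / 1) - invDegSum G) * ((+ (ℕ.suc n) / 1) - invDegSum G)
lemma5p2 n G = begin
  ι (2 ℕ.* edgeCount G)
    ≤⟨ quadratic-bound (nonIsolated G) (degree-sum-bound G) (nonIsolated-bound G) (degRatioSum-nonNeg G) ⟩
  T * (T + 1ℚ)
    ≡⟨ cong₂ (λ x y → x * (y + 1ℚ)) (degRatioSum≡n-invDegSum G) (degRatioSum≡n-invDegSum G) ⟩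
  (ι n - S) * (ι n - S + 1ℚ)
    ≡⟨ cong (_*_ (ι n - S)) (shift (ι n) S) ⟩
  (ι n - S) * (1ℚ + ι n - S)
    ≡⟨ cong (λ x → (ι n - S) * (x - S)) (ι-suc n) ⟨
  (ι n - S) * (ι (suc n) - S)
    ∎
  where
  open ℚ.≤-Reasoning
  T = degRatioSum G
  S = invDegSum G
  shift : ∀ x s → x - s + 1ℚ ≡ 1ℚ + x - s
  shift = solve-∀ ℚ-ring
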